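{- Let $x$ be a finite set. Then (1) the coinvariant space $\langle P(x)\rangle/S_x$ is isomorphic to $(\langle P[1]\rangle^{\otimes|x|})/S_{|x|}=\mathrm{Sym}^{|x|}\langle P[1]\rangle$, via a linear isomorphism intertwining the induced union, intersection and complement operations; and (2) $\dim(\langle P(x)\rangle/S_x)=|x|+1$.
   Context: $\mathbb{K}$ is a field of characteristic zero, $[n]=\{1,\dots,n\}$, $P[1]=P(\{1\})$. For a set $x$, $\langle P(x)\rangle$ is the $\mathbb{K}$-vector space with basis the subsets of $x$; union and intersection are the bilinear extensions of the set operations, and complement is the linear extension of $a\mapsto x\setminus a$. The symmetric group $S_x$ of $x$ acts on $\langle P(x)\rangle$ by $\sigma\cdot a=\sigma(a)$. If a finite group $G$ acts by automorphisms on a $\mathbb{K}$-algebra $A$, the coinvariant space $A/G=A/\langle ga-a: g\in G, a\in A\rangle$ carries the product $\bar a\,\bar b=\frac{1}{|G|}\sum_{g\in G}\overline{a\,(gb)}$; this is applied with both union and intersection as the product, and complement descends to $A/G$. $\langle P[1]\rangle^{\otimes n}$ carries componentwise union, intersection and complement, and $S_n$ acts by permuting tensor factors; $\mathrm{Sym}^n\langle P[1]\rangle=\langle P[1]\rangle^{\otimes n}/S_n$. -}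

module Defs where

open import Level using (Level; _⊔_) renaming (suc to lsuc)
open import Algebra.Bundles using (CommutativeRing)
open import Data.Nat using (ℕ; zero; suc; _!; ≢-nonZero⁻¹)
open import Data.Nat.Properties using (_!≢0)
open import Data.Bool using (Bool; true; false)
import Data.Bool as Bool
open import Data.Fin using (Fin)
open import Data.Fin.Subset using (Subset; _∪_; _∩_; ∁)
open import Data.Fin.Permutation using (Permutation′; _⟨$⟩ˡ_; id; transpose; lift₀; _∘ₚ_)
open import Data.Vec using (Vec; []; _∷_; tabulate; lookup; zipWith)
import Data.Vec as Vec
open import Data.Vec.Properties using (≡-dec)
open import Data.List using (List; []; _∷_; [_]; _++_; map; concatMap; allFin; foldr)
open import Data.Product using (Σ; ∃; _×_; _,_)
open import Relation.Binary.PropositionalEquality using (_≡_)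
open import Relation.Binary.Definitions using (DecidableEquality)
open import Relation.Nullary using (¬_; yes; no)

fromℕ : {c ℓ : Level} (R : CommutativeRing c ℓ) → ℕ → CommutativeRing.Carrier R
fromℕ R zero    = CommutativeRing.0# R
fromℕ R (suc m) = CommutativeRing._+_ R (CommutativeRing.1# R) (fromℕ R m)

record CharZeroField (c ℓ : Level) : Set (lsuc (c ⊔ ℓ)) where
  field
    cring : CommutativeRing c ℓ
  open CommutativeRing cring public
  field
    0≉1      : ¬ (0# ≈ 1#)
    inv      : (x : Carrier) → ¬ (x ≈ 0#) → Carrier
    inv-law  : (x : Carrier) (nz : ¬ (x ≈ 0#)) → x * inv x nz ≈ 1#
    charZero : (m : ℕ) → ¬ (m ≡ 0) → ¬ (fromℕ cring m ≈ 0#)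

-- all subsets of [n] = Fin n, i.e. the basis of ⟨P([n])⟩
allSubsets : (n : ℕ) → List (Subset n)
allSubsets zero    = [ [] ]
allSubsets (suc n) = map (true ∷_) (allSubsets n) ++ map (false ∷_) (allSubsets n)

-- all words of length n in the basis P[1] = Subset 1 of ⟨P[1]⟩,
-- i.e. the basis of ⟨P[1]⟩^{⊗n} (pure tensors of basis vectors)
allWords : (n : ℕ) → List (Vec (Subset 1) n)
allWords zero    = [ [] ]
allWords (suc n) = concatMap (λ s → map (s ∷_) (allWords n)) (allSubsets 1)

-- all permutations of Fin n (each exactly once): σ = transpose 0 i ∘ lift₀ π
allPerms : (n : ℕ) → List (Permutation′ n)
allPerms zero    = [ id ]
allPerms (suc n) =
  concatMap (λ i → map (λ π → lift₀ π ∘ₚ transpose Fin.zero i) (allPerms n)) (allFin (suc n))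

-- σ · a = σ(a) for a ⊆ [n]:   j ∈ σ(a)  iff  σ⁻¹ j ∈ a
actSubset : {n : ℕ} → Permutation′ n → Subset n → Subset n
actSubset σ a = tabulate (λ j → lookup a (σ ⟨$⟩ˡ j))

-- permuting tensor factors: the factor in position i moves to position σ i
actWord : {n : ℕ} → Permutation′ n → Vec (Subset 1) n → Vec (Subset 1) n
actWord σ w = tabulate (λ j → lookup w (σ ⟨$⟩ˡ j))

_∪w_ : {n : ℕ} → Vec (Subset 1) n → Vec (Subset 1) n → Vec (Subset 1) n
_∪w_ = zipWith _∪_

_∩w_ : {n : ℕ} → Vec (Subset 1) n → Vec (Subset 1) n → Vec (Subset 1) n
_∩w_ = zipWith _∩_

∁w : {n : ℕ} → Vec (Subset 1) n → Vec (Subset 1) n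
∁w = Vec.map ∁

module Constructions {c ℓ : Level} (F : CharZeroField c ℓ) where
  open CharZeroField F

  sumL : {a : Level} {X : Set a} → List X → (X → Carrier) → Carrier
  sumL xs f = foldr (λ x acc → f x + acc) 0# xs

  invFact : ℕ → Carrier
  invFact n = inv (fromℕ cring (n !)) (charZero (n !) (≢-nonZero⁻¹ (n !) {{n !≢0}}))

  -- The free K-vector space ⟨X⟩ on a finite basis X (enumerated by enum,
  -- with decidable equality), with the S_n–action induced by act on X.
  module Free (X : Set) (enum : List X) (_≟_ : DecidableEquality X)
              (n : ℕ) (act : Permutation′ n → X → X) where

    -- a vector is its coefficient function on the basis
    V : Set c
    V = X → Carrier

    _≈ᵥ_ : V → V → Set ℓ
    f ≈ᵥ g = (x : X) → f x ≈ g x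

    0ᵥ : V
    0ᵥ _ = 0#

    _+ᵥ_ : V → V → V
    (f +ᵥ g) x = f x + g x

    _-ᵥ_ : V → V → V
    (f -ᵥ g) x = f x - g x

    _·ᵥ_ : Carrier → V → V
    (k ·ᵥ f) x = k * f x

    sumV : {a : Level} {Y : Set a} → List Y → (Y → V) → V
    sumV ys h = foldr (λ y acc → h y +ᵥ acc) 0ᵥ ys

    [_≟ᵏ_] : X → X → Carrier
    [ a ≟ᵏ b ] with a ≟ b
    ... | yes _ = 1#
    ... | no _  = 0#

    lin1 : (X → X) → V → V
    lin1 h f y = sumL enum (λ a → [ h a ≟ᵏ y ] * f a)

    lin2 : (X → X → X) → V → V → V
    lin2 op f g y = sumL enum (λ a → sumL enum (λ b → [ op a b ≟ᵏ y ] * (f a * g b)))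

    _▷_ : Permutation′ n → V → V
    σ ▷ f = lin1 (act σ) f

    InSpan : V → Set (c ⊔ ℓ)
    InSpan v = Σ (List (Carrier × Permutation′ n × V)) λ ts →
                 v ≈ᵥ sumV ts (λ { (k , σ , h) → k ·ᵥ ((σ ▷ h) -ᵥ h) })

    -- equality in the coinvariant space ⟨X⟩ / S_n (on representatives)
    _~_ : V → V → Set (c ⊔ ℓ)
    f ~ g = InSpan (f -ᵥ g)

    -- induced product on coinvariants:  ā b̄ = 1/|S_n| Σ_σ \overline{a (σ b)}
    avg : (V → V → V) → V → V → V
    avg mul f g = invFact n ·ᵥ sumV (allPerms n) (λ σ → mul f (σ ▷ g))

    lincomb : {m : ℕ} → (Fin m → Carrier) → (Fin m → V) → V
    lincomb {m} k b = sumV (allFin m) (λ i → k i ·ᵥ b i)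

    HasDim : ℕ → Set (c ⊔ ℓ)
    HasDim m = Σ (Fin m → V) λ b →
                 ((k : Fin m → Carrier) → lincomb k b ~ 0ᵥ → (i : Fin m) → k i ≈ 0#)
               × ((f : V) → Σ (Fin m → Carrier) λ k → f ~ lincomb k b)

  module PSpace (n : ℕ) where
    open Free (Subset n) (allSubsets n) (≡-dec Bool._≟_) n actSubset public
    _∪ᶜ_ : V → V → V
    _∪ᶜ_ = avg (lin2 _∪_)
    _∩ᶜ_ : V → V → V
    _∩ᶜ_ = avg (lin2 _∩_)
    compl : V → V
    compl = lin1 ∁

  module TSpace (n : ℕ) where
    open Free (Vec (Subset 1) n) (allWords n) (≡-dec (≡-dec Bool._≟_)) n actWord public
    _∪ᶜ_ : V → V → V
    _∪ᶜ_ = avg (lin2 _∪w_)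
    _∩ᶜ_ : V → V → V
    _∩ᶜ_ = avg (lin2 _∩w_)
    compl : V → V
    compl = lin1 ∁w

  -- the conclusion of Proposition 3.3 for x = [n]
  Prop33 : ℕ → Set (c ⊔ ℓ)
  Prop33 n =
    (Σ (P.V → T.V) λ φ → Σ (T.V → P.V) λ ψ →
        ((f g : P.V) → f P.~ g → φ f T.~ φ g)
      × ((f g : T.V) → f T.~ g → ψ f P.~ ψ g)
      × ((f g : P.V) → φ (f P.+ᵥ g) T.~ (φ f T.+ᵥ φ g))
      × ((k : Carrier) (f : P.V) → φ (k P.·ᵥ f) T.~ (k T.·ᵥ φ f))
      × ((f : P.V) → ψ (φ f) P.~ f)
      × ((g : T.V) → φ (ψ g) T.~ g)
      × ((f g : P.V) → φ (f P.∪ᶜ g) T.~ (φ f T.∪ᶜ φ g))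
      × ((f g : P.V) → φ (f P.∩ᶜ g) T.~ (φ f T.∩ᶜ φ g))
      × ((f : P.V) → φ (P.compl f) T.~ T.compl (φ f)))
    × P.HasDim (suc n)
    where
      module P = PSpace n
      module T = TSpace n

{-# OPTIONS --safe #-}
-- Both spaces are permutation modules, and Vec.map [_] is an S_n-equivariant bijection
-- from subsets of [n] (as characteristic vectors) to words over P[1]. Precomposing with
-- its inverse is therefore a linear isomorphism that commutes with the actions and with
-- every linearly or bilinearly extended basis operation, so it descends to the
-- coinvariants and intertwines the averaged products.
--
-- For the dimension: in the coinvariants of a permutation module every basis vector e a
-- equals e of a fixed representative of its orbit, and for each orbit O the functional
-- v ↦ Σ_{a ∈ O} v a vanishes on every σ·h − h because the indicator of O is invariant,
-- so the orbit representatives form a basis. The orbits of S_n on subsets of [n] are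
-- the n + 1 size classes, represented by the initial segments.
module Submission where

open import Defs
open import Level using (Level)
open import Data.Nat using (ℕ; zero; suc; _≤_; z≤n; s≤s)
import Data.Nat.Properties as ℕ
open import Data.Bool using (Bool; if_then_else_; not; _∧_; _∨_)
import Data.Bool as Bool
open import Data.Fin as Fin using (Fin; toℕ; fromℕ<)
open import Data.Fin.Properties using (fromℕ<-cong; fromℕ<-toℕ; toℕ-fromℕ<; toℕ≤pred[n])
open import Data.Fin.Subset using (Subset; inside; outside; _∪_; _∩_; ∁; ∣_∣)
open import Data.Fin.Subset.Properties using (∣p∣≤n)
open import Data.Fin.Permutation using (Permutation′; _⟨$⟩ˡ_; transpose; lift₀; flip)
open import Data.Vec using (Vec; []; _∷_; [_]; head; lookup; zipWith)
import Data.Vec as Vec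
open import Data.Vec.Properties
  using (≡-dec; ∷-injectiveʳ; lookup∘tabulate; lookup-map; tabulate-cong; tabulate-∘; tabulate∘lookup)
open import Data.List using (List; []; _∷_; _++_; map; allFin)
open import Data.List.Properties using (map-id; map-cong; map-∘; map-++; ++-identityʳ)
open import Data.List.Membership.Propositional using (_∈_)
open import Data.List.Membership.Propositional.Properties
  using (∈-allFin; ∈-map⁺; ∈-map⁻; ∈-++⁺ˡ; ∈-++⁺ʳ)
open import Data.List.Relation.Unary.Any using (here; there)
open import Data.List.Relation.Unary.Unique.Propositional using (Unique)
open import Data.List.Relation.Unary.AllPairs using ([]; _∷_)
open import Data.List.Relation.Unary.All as All using (All; []; _∷_)
open import Data.List.Relation.Unary.Unique.Propositional.Properties using (allFin⁺; map⁺; ++⁺)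
open import Data.List.Relation.Binary.Disjoint.Propositional using (Disjoint)
open import Data.Product using (∃; _×_; _,_; map₁; map₂)
open import Data.Maybe using (nothing)
open import Relation.Nullary using (Dec; yes; no; ¬_; contradiction)
open import Relation.Binary.Definitions using (DecidableEquality)
open import Tactic.RingSolver.Core.AlmostCommutativeRing using (fromCommutativeRing)
open import Function using (id; _∘_; _↔_; mk↔ₛ′; Inverse; _⇔_; mk⇔; Equivalence)
open import Function.Properties.Inverse using (↔-sym)
open import Relation.Binary.PropositionalEquality as ≡ using (_≡_; _≢_; module ≡-Reasoning)
open import Relation.Binary.Construct.Closure.ReflexiveTransitive using (Star; ε; _◅_; _◅◅_; gmap)
open import Algebra.Properties.CommutativeMonoid.Sum ℕ.+-0-commutativeMonoid
  using (sum; sum-permute; sum-cong-≗)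

-- Orbits are described by reachability, Star (Moves act), so that no composition law
-- for the actions is needed.
Moves : ∀ {n} {X : Set} → (Permutation′ n → X → X) → X → X → Set
Moves act a b = ∃ λ σ → act σ a ≡ b

module _ {a b} {A : Set a} {B : Set b} (ι : A ↔ B) where
  open Inverse ι using (to; from; strictlyInverseˡ; strictlyInverseʳ; inverseʳ)

  map-from : ∀ {xs ys} → ys ≡ map to xs → xs ≡ map from ys
  map-from {xs} {ys} ys≡ = begin
    xs                   ≡⟨ map-id xs ⟨
    map id xs            ≡⟨ map-cong (≡.sym ∘ strictlyInverseʳ) xs ⟩
    map (from ∘ to) xs   ≡⟨ map-∘ xs ⟩
    map from (map to xs) ≡⟨ ≡.cong (map from) ys≡ ⟨
    map from ys          ∎
    where open ≡-Reasoning

  from-equivariant : ∀ {p} {P : Set p} {f : P → A → A} {g : P → B → B} →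
                     (∀ σ x → to (f σ x) ≡ g σ (to x)) → ∀ σ y → from (g σ y) ≡ f σ (from y)
  from-equivariant {f = f} {g} to-equivariant σ y = inverseʳ (≡.sym (begin
    to (f σ (from y))   ≡⟨ to-equivariant σ (from y) ⟩
    g σ (to (from y))   ≡⟨ ≡.cong (g σ) (strictlyInverseˡ y) ⟩
    g σ y               ∎))
    where open ≡-Reasoning

allSubsets-unique : ∀ n → Unique (allSubsets n)
allSubsets-unique zero    = [] ∷ []
allSubsets-unique (suc n) = ++⁺ (map⁺ ∷-injectiveʳ u) (map⁺ ∷-injectiveʳ u) heads-differ
  where
  u = allSubsets-unique n
  heads-differ : Disjoint (map (inside ∷_) (allSubsets n)) (map (outside ∷_) (allSubsets n))
  heads-differ (p , q) with ∈-map⁻ (inside ∷_) p | ∈-map⁻ (outside ∷_) q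
  ... | _ , _ , ≡.refl | _ , _ , ()

∈-allSubsets : ∀ {n} (p : Subset n) → p ∈ allSubsets n
∈-allSubsets []            = here ≡.refl
∈-allSubsets (inside ∷ p)  = ∈-++⁺ˡ (∈-map⁺ (inside ∷_) (∈-allSubsets p))
∈-allSubsets (outside ∷ p) =
  ∈-++⁺ʳ (map (inside ∷_) (allSubsets _)) (∈-map⁺ (outside ∷_) (∈-allSubsets p))

∣p∣≡sum : ∀ {n} (p : Subset n) → ∣ p ∣ ≡ sum (λ i → if lookup p i then 1 else 0)
∣p∣≡sum []            = ≡.refl
∣p∣≡sum (inside ∷ p)  = ≡.cong suc (∣p∣≡sum p)
∣p∣≡sum (outside ∷ p) = ∣p∣≡sum p

∣actSubset∣ : ∀ {n} (σ : Permutation′ n) (p : Subset n) → ∣ actSubset σ p ∣ ≡ ∣ p ∣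
∣actSubset∣ σ p = begin
  ∣ actSubset σ p ∣                    ≡⟨ ∣p∣≡sum (actSubset σ p) ⟩
  sum (χ ∘ lookup (actSubset σ p))     ≡⟨ sum-cong-≗ (≡.cong χ ∘ lookup∘tabulate (lookup p ∘ (σ ⟨$⟩ˡ_))) ⟩
  sum (λ j → χ (lookup p (σ ⟨$⟩ˡ j)))  ≡⟨ sum-permute (χ ∘ lookup p) (flip σ) ⟨
  sum (χ ∘ lookup p)                   ≡⟨ ∣p∣≡sum p ⟨
  ∣ p ∣                                ∎
  where
  open ≡-Reasoning
  χ : Bool → ℕ
  χ b = if b then 1 else 0

-- The initial segment {0, …, k − 1}, truncated to all of Fin n when k > n.
prefix : ∀ {n} → ℕ → Subset n
prefix {zero}  _       = []
prefix {suc n} zero    = outside ∷ prefix zero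
prefix {suc n} (suc k) = inside ∷ prefix k

∣prefix∣ : ∀ {n k} → k ≤ n → ∣ prefix {n} k ∣ ≡ k
∣prefix∣ {zero}  z≤n       = ≡.refl
∣prefix∣ {suc n} z≤n       = ∣prefix∣ {n} z≤n
∣prefix∣ {suc n} (s≤s k≤n) = ≡.cong suc (∣prefix∣ k≤n)

infix 4 _↝*_
_↝*_ : ∀ {n} → Subset n → Subset n → Set
_↝*_ = Star (Moves actSubset)

↝*-cons : ∀ {n} x {p q : Subset n} → p ↝* q → (x ∷ p) ↝* (x ∷ q)
↝*-cons x = gmap (x ∷_) λ (σ , σp≡q) → lift₀ σ , ≡.cong (x ∷_) σp≡q

outside∷prefix↝* : ∀ {n k} → k ≤ n → (outside ∷ prefix {n} k) ↝* prefix {suc n} k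
outside∷prefix↝* {k = zero}          _         = ε
outside∷prefix↝* {suc n} {k = suc k} (s≤s k≤n) =
  (transpose Fin.zero (Fin.suc Fin.zero) , ≡.cong (λ p → inside ∷ outside ∷ p) (tabulate∘lookup _))
  ◅ ↝*-cons inside (outside∷prefix↝* k≤n)

↝*-prefix : ∀ {n} (p : Subset n) → p ↝* prefix ∣ p ∣
↝*-prefix []            = ε
↝*-prefix (inside ∷ p)  = ↝*-cons inside (↝*-prefix p)
↝*-prefix (outside ∷ p) = ↝*-cons outside (↝*-prefix p) ◅◅ outside∷prefix↝* (∣p∣≤n p)

singletons : ∀ {a} {A : Set a} {n} → Vec A n ↔ Vec (Vec A 1) n
singletons = mk↔ₛ′ (Vec.map [_]) (Vec.map head) map-[_]-head map-head-[_]
  where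
  map-[_]-head : ∀ {a} {A : Set a} {n} (w : Vec (Vec A 1) n) → Vec.map [_] (Vec.map head w) ≡ w
  map-[_]-head []             = ≡.refl
  map-[_]-head ((x ∷ []) ∷ w) = ≡.cong ([ x ] ∷_) (map-[_]-head w)
  map-head-[_] : ∀ {a} {A : Set a} {n} (v : Vec A n) → Vec.map head (Vec.map [_] v) ≡ v
  map-head-[_] []      = ≡.refl
  map-head-[_] (x ∷ v) = ≡.cong (x ∷_) (map-head-[_] v)

allWords≡ : ∀ n → allWords n ≡ map (Vec.map [_]) (allSubsets n)
allWords≡ zero    = ≡.refl
allWords≡ (suc n) = begin
  map ([ inside ] ∷_) (allWords n) ++ (map ([ outside ] ∷_) (allWords n) ++ [])
    ≡⟨ ≡.cong (λ W → map ([ inside ] ∷_) W ++ (map ([ outside ] ∷_) W ++ [])) (allWords≡ n) ⟩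
  map ([ inside ] ∷_) (map emb S) ++ (map ([ outside ] ∷_) (map emb S) ++ [])
    ≡⟨ ≡.cong₂ _++_ (cons-emb inside) (≡.trans (++-identityʳ _) (cons-emb outside)) ⟩
  map emb (map (inside ∷_) S) ++ map emb (map (outside ∷_) S)
    ≡⟨ map-++ emb (map (inside ∷_) S) (map (outside ∷_) S) ⟨
  map emb (allSubsets (suc n)) ∎
  where
  open ≡-Reasoning
  S = allSubsets n
  emb : ∀ {m} → Subset m → Vec (Subset 1) m
  emb = Vec.map [_]
  cons-emb : ∀ x → map ([ x ] ∷_) (map emb S) ≡ map emb (map (x ∷_) S)
  cons-emb x = ≡.trans (≡.sym (map-∘ S)) (map-∘ S)

map-[_]-actSubset : ∀ {n} (σ : Permutation′ n) (p : Subset n) →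
                    Vec.map [_] (actSubset σ p) ≡ actWord σ (Vec.map [_] p)
map-[_]-actSubset σ p =
  ≡.sym (≡.trans (tabulate-cong λ j → lookup-map (σ ⟨$⟩ˡ j) [_] p) (tabulate-∘ [_] _))

map-[_]-zipWith : ∀ {a} {A : Set a} {n} (f : A → A → A) (u v : Vec A n) →
                  Vec.map [_] (zipWith f u v) ≡ zipWith (zipWith f) (Vec.map [_] u) (Vec.map [_] v)
map-[_]-zipWith f []      []      = ≡.refl
map-[_]-zipWith f (x ∷ u) (y ∷ v) = ≡.cong ([ f x y ] ∷_) (map-[_]-zipWith f u v)

map-[_]-map : ∀ {a} {A : Set a} {n} (f : A → A) (v : Vec A n) →
              Vec.map [_] (Vec.map f v) ≡ Vec.map (Vec.map f) (Vec.map [_] v)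
map-[_]-map f []      = ≡.refl
map-[_]-map f (x ∷ v) = ≡.cong ([ f x ] ∷_) (map-[_]-map f v)

size : ∀ {n} → Subset n → Fin (suc n)
size p = fromℕ< (s≤s (∣p∣≤n p))

size-actSubset : ∀ {n} (σ : Permutation′ n) (p : Subset n) → size (actSubset σ p) ≡ size p
size-actSubset σ p = fromℕ<-cong _ _ (∣actSubset∣ σ p) _ _

size-prefix : ∀ {n} (i : Fin (suc n)) → size (prefix {n} (toℕ i)) ≡ i
size-prefix i =
  ≡.trans (fromℕ<-cong _ _ (∣prefix∣ (toℕ≤pred[n] i)) _ _) (fromℕ<-toℕ i (s≤s (toℕ≤pred[n] i)))

↝*-prefix-size : ∀ {n} (p : Subset n) → p ↝* prefix (toℕ (size p))
↝*-prefix-size p = ≡.subst (λ k → p ↝* prefix k) (≡.sym (toℕ-fromℕ< _)) (↝*-prefix p)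

module Coinvariants {c ℓ : Level} (F : CharZeroField c ℓ) where
  open CharZeroField F hiding (zero)
  open Constructions F
  open import Algebra.Properties.Ring ring using (-1*x≈-x; ⁻¹-anti-homo‿-; x[y-z]≈xy-xz; -0#≈0#)
  open import Algebra.Properties.CommutativeSemigroup *-commutativeSemigroup using (x∙yz≈y∙xz; x∙yz≈yx∙z)
  open import Relation.Binary.Reasoning.Setoid setoid
  open import Tactic.RingSolver.NonReflective (fromCommutativeRing cring (λ _ → nothing))
    using (solve; _⊜_; _⊕_; ⊝_)

  ⟦_⟧ : ∀ {p} {P : Set p} → Dec P → Carrier
  ⟦ yes _ ⟧ = 1#
  ⟦ no _ ⟧  = 0#

  ⟦⟧-yes : ∀ {p} {P : Set p} (p? : Dec P) → P → ⟦ p? ⟧ ≈ 1#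
  ⟦⟧-yes (yes _) _  = refl
  ⟦⟧-yes (no ¬p) p = contradiction p ¬p

  ⟦⟧-no : ∀ {p} {P : Set p} (p? : Dec P) → ¬ P → ⟦ p? ⟧ ≈ 0#
  ⟦⟧-no (yes p) ¬p = contradiction p ¬p
  ⟦⟧-no (no _)  _  = refl

  ⟦⟧-⇔ : ∀ {p q} {P : Set p} {Q : Set q} → P ⇔ Q → (p? : Dec P) (q? : Dec Q) → ⟦ p? ⟧ ≈ ⟦ q? ⟧
  ⟦⟧-⇔ P⇔Q (yes p) q? = sym (⟦⟧-yes q? (Equivalence.to P⇔Q p))
  ⟦⟧-⇔ P⇔Q (no ¬p) q? = sym (⟦⟧-no q? (¬p ∘ Equivalence.from P⇔Q))

  module _ {a} {A : Set a} where

    sumL-cong : ∀ xs {f g : A → Carrier} → (∀ x → f x ≈ g x) → sumL xs f ≈ sumL xs g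
    sumL-cong []       f≈g = refl
    sumL-cong (x ∷ xs) f≈g = +-cong (f≈g x) (sumL-cong xs f≈g)

    sumL-zero : ∀ xs {f : A → Carrier} → (∀ x → f x ≈ 0#) → sumL xs f ≈ 0#
    sumL-zero []       f≈0 = refl
    sumL-zero (x ∷ xs) f≈0 = trans (+-cong (f≈0 x) (sumL-zero xs f≈0)) (+-identityʳ 0#)

    sumL-+ : ∀ xs (f g : A → Carrier) → sumL xs (λ x → f x + g x) ≈ sumL xs f + sumL xs g
    sumL-+ []       f g = sym (+-identityʳ 0#)
    sumL-+ (x ∷ xs) f g = trans (+-congˡ (sumL-+ xs f g))
      (solve 4 (λ a b c d → ((a ⊕ b) ⊕ (c ⊕ d)) ⊜ ((a ⊕ c) ⊕ (b ⊕ d))) refl _ _ _ _)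

    sumL-‿- : ∀ xs (f g : A → Carrier) → sumL xs (λ x → f x - g x) ≈ sumL xs f - sumL xs g
    sumL-‿- []       f g = sym (-‿inverseʳ 0#)
    sumL-‿- (x ∷ xs) f g = trans (+-congˡ (sumL-‿- xs f g))
      (solve 4 (λ a b c d → ((a ⊕ ⊝ b) ⊕ (c ⊕ ⊝ d)) ⊜ ((a ⊕ c) ⊕ ⊝ (b ⊕ d))) refl _ _ _ _)

    sumL-*ˡ : ∀ k xs (f : A → Carrier) → k * sumL xs f ≈ sumL xs (λ x → k * f x)
    sumL-*ˡ k []       f = zeroʳ k
    sumL-*ˡ k (x ∷ xs) f = trans (distribˡ k _ _) (+-congˡ (sumL-*ˡ k xs f))

    sumL-*ʳ : ∀ xs (f : A → Carrier) k → sumL xs f * k ≈ sumL xs (λ x → f x * k)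
    sumL-*ʳ xs f k = trans (*-comm _ k) (trans (sumL-*ˡ k xs f) (sumL-cong xs λ x → *-comm k (f x)))

    sumL-map : ∀ {b} {B : Set b} (g : B → A) ys (f : A → Carrier) →
               sumL (map g ys) f ≡ sumL ys (f ∘ g)
    sumL-map g []       f = ≡.refl
    sumL-map g (y ∷ ys) f = ≡.cong (f (g y) +_) (sumL-map g ys f)

  sumL-swap : ∀ {a b} {A : Set a} {B : Set b} xs ys (f : A → B → Carrier) →
              sumL xs (λ x → sumL ys (f x)) ≈ sumL ys (λ y → sumL xs (λ x → f x y))
  sumL-swap []       ys f = sym (sumL-zero ys λ _ → refl)
  sumL-swap (x ∷ xs) ys f = trans (+-congˡ (sumL-swap xs ys f)) (sym (sumL-+ ys (f x) _))

  module _ {a} {A : Set a} (_≟_ : DecidableEquality A) where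

    ⟦≟⟧-sym : ∀ x y → ⟦ x ≟ y ⟧ ≈ ⟦ y ≟ x ⟧
    ⟦≟⟧-sym x y = ⟦⟧-⇔ (mk⇔ ≡.sym ≡.sym) (x ≟ y) (y ≟ x)

    sumL-⟦≟⟧-∉ : ∀ {xs y} → All (_≢ y) xs → (g : A → Carrier) →
                 sumL xs (λ x → ⟦ x ≟ y ⟧ * g x) ≈ 0#
    sumL-⟦≟⟧-∉ []           g = refl
    sumL-⟦≟⟧-∉ {x ∷ _} {y} (x≢y ∷ xs≢y) g =
      trans (+-cong (trans (*-congʳ (⟦⟧-no (x ≟ y) x≢y)) (zeroˡ _)) (sumL-⟦≟⟧-∉ xs≢y g))
            (+-identityʳ 0#)

    sumL-⟦≟⟧ : ∀ {xs y} → Unique xs → y ∈ xs → (g : A → Carrier) →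
               sumL xs (λ x → ⟦ x ≟ y ⟧ * g x) ≈ g y
    sumL-⟦≟⟧ {y = y} (x≢xs ∷ _) (here ≡.refl) g =
      trans (+-cong (trans (*-congʳ (⟦⟧-yes (y ≟ y) ≡.refl)) (*-identityˡ _))
                    (sumL-⟦≟⟧-∉ (All.map (_∘ ≡.sym) x≢xs) g))
            (+-identityʳ _)
    sumL-⟦≟⟧ {x ∷ _} {y} (x≢xs ∷ xs!) (there y∈xs) g =
      trans (+-cong (trans (*-congʳ (⟦⟧-no (x ≟ y) (All.lookup x≢xs y∈xs))) (zeroˡ _))
                    (sumL-⟦≟⟧ xs! y∈xs g))
            (+-identityˡ _)

    sumL-⟦≟⟧′ : ∀ {xs y} → Unique xs → y ∈ xs → (g : A → Carrier) →
                sumL xs (λ x → ⟦ y ≟ x ⟧ * g x) ≈ g y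
    sumL-⟦≟⟧′ {xs} {y} xs! y∈xs g =
      trans (sumL-cong xs λ x → *-congʳ (⟦≟⟧-sym y x)) (sumL-⟦≟⟧ xs! y∈xs g)

  module FreeProperties (X : Set) (enum : List X) (_≟_ : DecidableEquality X)
                        (n : ℕ) (act : Permutation′ n → X → X) where
    open Free X enum _≟_ n act

    [≟ᵏ]≡⟦≟⟧ : ∀ a b → [ a ≟ᵏ b ] ≡ ⟦ a ≟ b ⟧
    [≟ᵏ]≡⟦≟⟧ a b with a ≟ b
    ... | yes _ = ≡.refl
    ... | no _  = ≡.refl

    sumV-pt : ∀ {a} {Y : Set a} (ys : List Y) (h : Y → V) x →
              sumV ys h x ≡ sumL ys (λ y → h y x)
    sumV-pt []       h x = ≡.refl
    sumV-pt (y ∷ ys) h x = ≡.cong (h y x +_) (sumV-pt ys h x)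

    lin2-congʳ : ∀ op f {g g′} → g ≈ᵥ g′ → lin2 op f g ≈ᵥ lin2 op f g′
    lin2-congʳ op f g≈g′ y = sumL-cong enum λ a → sumL-cong enum λ b → *-congˡ (*-congˡ (g≈g′ b))

    relator : Carrier × Permutation′ n × V → V
    relator (k , σ , h) = k ·ᵥ ((σ ▷ h) -ᵥ h)

    InSpan-resp-≈ᵥ : ∀ {v w} → v ≈ᵥ w → InSpan w → InSpan v
    InSpan-resp-≈ᵥ v≈w (ts , w≈) = ts , λ x → trans (v≈w x) (w≈ x)

    InSpan-+ᵥ : ∀ {v w} → InSpan v → InSpan w → InSpan (v +ᵥ w)
    InSpan-+ᵥ (ts , v≈) (us , w≈) =
      ts ++ us , λ x → trans (+-cong (v≈ x) (w≈ x)) (sym (sumV-++ ts x))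
      where
      sumV-++ : ∀ ts x → sumV (ts ++ us) relator x ≈ sumV ts relator x + sumV us relator x
      sumV-++ []       x = sym (+-identityˡ _)
      sumV-++ (t ∷ ts) x = trans (+-congˡ (sumV-++ ts x)) (sym (+-assoc _ _ _))

    InSpan-·ᵥ : ∀ {v} k → InSpan v → InSpan (k ·ᵥ v)
    InSpan-·ᵥ k (ts , v≈) = map (map₁ (k *_)) ts , λ x → trans (*-congˡ (v≈ x)) (scale ts x)
      where
      scale : ∀ ts x → k * sumV ts relator x ≈ sumV (map (map₁ (k *_)) ts) relator x
      scale []                  x = zeroʳ k
      scale ((k′ , σ , h) ∷ ts) x =
        trans (distribˡ k _ _) (+-cong (sym (*-assoc k k′ _)) (scale ts x))

    InSpan-relator : ∀ σ h → InSpan ((σ ▷ h) -ᵥ h)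
    InSpan-relator σ h = (1# , σ , h) ∷ [] , λ x → sym (trans (+-identityʳ _) (*-identityˡ _))

    ~-reflexive : ∀ {f g} → f ≈ᵥ g → f ~ g
    ~-reflexive {f} {g} f≈g = [] , λ x → trans (+-congʳ (f≈g x)) (-‿inverseʳ (g x))

    ~-sym : ∀ {f g} → f ~ g → g ~ f
    ~-sym {f} {g} f~g = InSpan-resp-≈ᵥ (λ x → sym (trans (-1*x≈-x _) (⁻¹-anti-homo‿- (f x) (g x))))
                                       (InSpan-·ᵥ (- 1#) f~g)

    ~-trans : ∀ {f g h} → f ~ g → g ~ h → f ~ h
    ~-trans {f} {g} {h} f~g g~h = InSpan-resp-≈ᵥ (λ x → telescope (f x) (g x) (h x)) (InSpan-+ᵥ f~g g~h)
      where
      -- Not by solve: the solver is instantiated without a zero test, so it cannot cancel b − b.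
      telescope : ∀ a b d → a - d ≈ (a - b) + (b - d)
      telescope a b d = sym (begin
        (a - b) + (b - d)    ≈⟨ +-assoc a (- b) (b - d) ⟩
        a + (- b + (b - d))  ≈⟨ +-congˡ (+-assoc (- b) b (- d)) ⟨
        a + ((- b + b) - d)  ≈⟨ +-congˡ (+-congʳ (-‿inverseˡ b)) ⟩
        a + (0# - d)         ≈⟨ +-congˡ (+-identityˡ (- d)) ⟩
        a - d                ∎)

    +ᵥ-cong-~ : ∀ {f f′ g g′} → f ~ f′ → g ~ g′ → (f +ᵥ g) ~ (f′ +ᵥ g′)
    +ᵥ-cong-~ {f} {f′} {g} {g′} f~f′ g~g′ =
      InSpan-resp-≈ᵥ (λ x → interchange (f x) (g x) (f′ x) (g′ x)) (InSpan-+ᵥ f~f′ g~g′)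
      where
      interchange : ∀ a b a′ b′ → (a + b) - (a′ + b′) ≈ (a - a′) + (b - b′)
      interchange = solve 4 (λ a b a′ b′ → ((a ⊕ b) ⊕ ⊝ (a′ ⊕ b′)) ⊜ ((a ⊕ ⊝ a′) ⊕ (b ⊕ ⊝ b′))) refl

    ·ᵥ-cong-~ : ∀ {f g} k → f ~ g → (k ·ᵥ f) ~ (k ·ᵥ g)
    ·ᵥ-cong-~ {f} {g} k f~g =
      InSpan-resp-≈ᵥ (λ x → sym (x[y-z]≈xy-xz k (f x) (g x))) (InSpan-·ᵥ k f~g)

    sumV-cong-~ : ∀ {a} {Y : Set a} (ys : List Y) {h h′ : Y → V} →
                  (∀ y → h y ~ h′ y) → sumV ys h ~ sumV ys h′
    sumV-cong-~ []       h~h′ = ~-reflexive λ _ → refl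
    sumV-cong-~ (y ∷ ys) h~h′ = +ᵥ-cong-~ (h~h′ y) (sumV-cong-~ ys h~h′)

    ⟪_,_⟫ : (X → Carrier) → V → Carrier
    ⟪ w , v ⟫ = sumL enum (λ a → w a * v a)

    ⟪⟫-cong : ∀ {w w′ v v′} → (∀ a → w a ≈ w′ a) → v ≈ᵥ v′ → ⟪ w , v ⟫ ≈ ⟪ w′ , v′ ⟫
    ⟪⟫-cong w≈w′ v≈v′ = sumL-cong enum λ a → *-cong (w≈w′ a) (v≈v′ a)

    ⟪⟫-·ᵥ : ∀ w k v → ⟪ w , k ·ᵥ v ⟫ ≈ k * ⟪ w , v ⟫
    ⟪⟫-·ᵥ w k v =
      trans (sumL-cong enum λ a → x∙yz≈y∙xz (w a) k (v a)) (sym (sumL-*ˡ k enum _))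

    ⟪⟫-‿-ᵥ : ∀ w u v → ⟪ w , u -ᵥ v ⟫ ≈ ⟪ w , u ⟫ - ⟪ w , v ⟫
    ⟪⟫-‿-ᵥ w u v = trans (sumL-cong enum λ a → x[y-z]≈xy-xz (w a) (u a) (v a)) (sumL-‿- enum _ _)

    ⟪⟫-sumV : ∀ {a} {Y : Set a} w (ys : List Y) (h : Y → V) →
              ⟪ w , sumV ys h ⟫ ≈ sumL ys (λ y → ⟪ w , h y ⟫)
    ⟪⟫-sumV w ys h = begin
      sumL enum (λ a → w a * sumV ys h a)
        ≈⟨ sumL-cong enum (λ a → *-congˡ (reflexive (sumV-pt ys h a))) ⟩
      sumL enum (λ a → w a * sumL ys (λ y → h y a))
        ≈⟨ sumL-cong enum (λ a → sumL-*ˡ (w a) ys _) ⟩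
      sumL enum (λ a → sumL ys (λ y → w a * h y a))
        ≈⟨ sumL-swap enum ys _ ⟩
      sumL ys (λ y → ⟪ w , h y ⟫)
        ∎

    module Basis (enum-unique : Unique enum) (∈-enum : ∀ a → a ∈ enum) where

      sum-[≟ᵏ] : ∀ (g : X → Carrier) y → sumL enum (λ a → [ a ≟ᵏ y ] * g a) ≈ g y
      sum-[≟ᵏ] g y = trans (sumL-cong enum λ a → *-congʳ (reflexive ([≟ᵏ]≡⟦≟⟧ a y)))
                           (sumL-⟦≟⟧ _≟_ enum-unique (∈-enum y) g)

      sum-[≟ᵏ]′ : ∀ (g : X → Carrier) y → sumL enum (λ a → [ y ≟ᵏ a ] * g a) ≈ g y
      sum-[≟ᵏ]′ g y = trans (sumL-cong enum λ a → *-congʳ (reflexive ([≟ᵏ]≡⟦≟⟧ y a)))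
                            (sumL-⟦≟⟧′ _≟_ enum-unique (∈-enum y) g)

      e : X → V
      e a b = [ a ≟ᵏ b ]

      expand : ∀ f → f ≈ᵥ sumV enum (λ a → f a ·ᵥ e a)
      expand f y = sym (begin
        sumV enum (λ a → f a ·ᵥ e a) y          ≡⟨ sumV-pt enum _ y ⟩
        sumL enum (λ a → f a * [ a ≟ᵏ y ])      ≈⟨ sumL-cong enum (λ a → *-comm (f a) _) ⟩
        sumL enum (λ a → [ a ≟ᵏ y ] * f a)      ≈⟨ sum-[≟ᵏ] f y ⟩
        f y                                     ∎)

      ▷-e : ∀ σ a → (σ ▷ e a) ≈ᵥ e (act σ a)
      ▷-e σ a y =
        trans (sumL-cong enum λ b → *-comm _ (e a b)) (sum-[≟ᵏ]′ (λ b → [ act σ b ≟ᵏ y ]) a)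

      e-act-~ : ∀ σ a → e (act σ a) ~ e a
      e-act-~ σ a = InSpan-resp-≈ᵥ (λ y → +-congʳ (sym (▷-e σ a y))) (InSpan-relator σ (e a))

      e-resp-↝* : ∀ {a b} → Star (Moves act) a b → e a ~ e b
      e-resp-↝* ε                    = ~-reflexive λ _ → refl
      e-resp-↝* ((σ , ≡.refl) ◅ a↝b) = ~-trans (~-sym (e-act-~ σ _)) (e-resp-↝* a↝b)

      ⟪⟫-e : ∀ w a → ⟪ w , e a ⟫ ≈ w a
      ⟪⟫-e w a = trans (sumL-cong enum λ b → *-comm (w b) _) (sum-[≟ᵏ]′ w a)

      ⟪⟫-▷ : ∀ w σ v → ⟪ w , σ ▷ v ⟫ ≈ ⟪ w ∘ act σ , v ⟫
      ⟪⟫-▷ w σ v = begin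
        sumL enum (λ y → w y * sumL enum (λ a → [ act σ a ≟ᵏ y ] * v a))
          ≈⟨ sumL-cong enum (λ y → sumL-*ˡ (w y) enum _) ⟩
        sumL enum (λ y → sumL enum (λ a → w y * ([ act σ a ≟ᵏ y ] * v a)))
          ≈⟨ sumL-swap enum enum _ ⟩
        sumL enum (λ a → sumL enum (λ y → w y * ([ act σ a ≟ᵏ y ] * v a)))
          ≈⟨ sumL-cong enum (λ a → sumL-cong enum λ y → x∙yz≈y∙xz (w y) _ (v a)) ⟩
        sumL enum (λ a → sumL enum (λ y → [ act σ a ≟ᵏ y ] * (w y * v a)))
          ≈⟨ sumL-cong enum (λ a → sum-[≟ᵏ]′ (λ y → w y * v a) (act σ a)) ⟩
        ⟪ w ∘ act σ , v ⟫
          ∎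

      ⟪⟫-InSpan : ∀ {w v} → (∀ σ a → w (act σ a) ≈ w a) → InSpan v → ⟪ w , v ⟫ ≈ 0#
      ⟪⟫-InSpan {w} {v} w-invariant (ts , v≈) = begin
        ⟪ w , v ⟫                          ≈⟨ ⟪⟫-cong (λ _ → refl) v≈ ⟩
        ⟪ w , sumV ts relator ⟫            ≈⟨ ⟪⟫-sumV w ts relator ⟩
        sumL ts (λ t → ⟪ w , relator t ⟫)  ≈⟨ sumL-zero ts ⟪w,relator⟫≈0 ⟩
        0#                                 ∎
        where
        ⟪w,relator⟫≈0 : ∀ t → ⟪ w , relator t ⟫ ≈ 0#
        ⟪w,relator⟫≈0 (k , σ , h) = begin
          ⟪ w , k ·ᵥ ((σ ▷ h) -ᵥ h) ⟫         ≈⟨ ⟪⟫-·ᵥ w k _ ⟩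
          k * ⟪ w , (σ ▷ h) -ᵥ h ⟫            ≈⟨ *-congˡ (⟪⟫-‿-ᵥ w (σ ▷ h) h) ⟩
          k * (⟪ w , σ ▷ h ⟫ - ⟪ w , h ⟫)     ≈⟨ *-congˡ (+-congʳ (⟪⟫-▷ w σ h)) ⟩
          k * (⟪ w ∘ act σ , h ⟫ - ⟪ w , h ⟫) ≈⟨ *-congˡ (+-congʳ (⟪⟫-cong (w-invariant σ) (λ _ → refl))) ⟩
          k * (⟪ w , h ⟫ - ⟪ w , h ⟫)         ≈⟨ *-congˡ (-‿inverseʳ _) ⟩
          k * 0#                              ≈⟨ zeroʳ k ⟩
          0#                                  ∎

      module Orbits {m : ℕ} (orbit : X → Fin m) (orbit-act : ∀ σ a → orbit (act σ a) ≡ orbit a)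
                    (rep : Fin m → X) (orbit-rep : ∀ i → orbit (rep i) ≡ i)
                    (↝*-rep : ∀ a → Star (Moves act) a (rep (orbit a))) where

        χ : Fin m → X → Carrier
        χ i a = ⟦ orbit a Fin.≟ i ⟧

        χ-invariant : ∀ i σ a → χ i (act σ a) ≈ χ i a
        χ-invariant i σ a = reflexive (≡.cong (λ j → ⟦ j Fin.≟ i ⟧) (orbit-act σ a))

        χ-rep : ∀ i j → χ i (rep j) ≈ ⟦ j Fin.≟ i ⟧
        χ-rep i j = reflexive (≡.cong (λ j′ → ⟦ j′ Fin.≟ i ⟧) (orbit-rep j))

        basis : Fin m → V
        basis i = e (rep i)

        coordinates : V → Fin m → Carrier
        coordinates f i = ⟪ χ i , f ⟫

        ⟪χ,lincomb⟫ : ∀ k i → ⟪ χ i , lincomb k basis ⟫ ≈ k i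
        ⟪χ,lincomb⟫ k i = begin
          ⟪ χ i , lincomb k basis ⟫
            ≈⟨ ⟪⟫-sumV (χ i) (allFin m) _ ⟩
          sumL (allFin m) (λ j → ⟪ χ i , k j ·ᵥ basis j ⟫)
            ≈⟨ sumL-cong (allFin m) (λ j → trans (⟪⟫-·ᵥ (χ i) (k j) _) (*-congˡ (⟪⟫-e (χ i) (rep j)))) ⟩
          sumL (allFin m) (λ j → k j * χ i (rep j))
            ≈⟨ sumL-cong (allFin m) (λ j → trans (*-comm (k j) _) (*-congʳ (χ-rep i j))) ⟩
          sumL (allFin m) (λ j → ⟦ j Fin.≟ i ⟧ * k j)
            ≈⟨ sumL-⟦≟⟧ Fin._≟_ (allFin⁺ m) (∈-allFin i) k ⟩
          k i
            ∎

        independent : ∀ k → lincomb k basis ~ 0ᵥ → ∀ i → k i ≈ 0#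
        independent k k~0 i = begin
          k i                                ≈⟨ ⟪χ,lincomb⟫ k i ⟨
          ⟪ χ i , lincomb k basis ⟫          ≈⟨ ⟪⟫-cong (λ _ → refl) (λ a → x-0≈x _) ⟨
          ⟪ χ i , lincomb k basis -ᵥ 0ᵥ ⟫    ≈⟨ ⟪⟫-InSpan (χ-invariant i) k~0 ⟩
          0#                                 ∎
          where
          x-0≈x : ∀ x → x - 0# ≈ x
          x-0≈x x = trans (+-congˡ -0#≈0#) (+-identityʳ x)

        regroup : ∀ f → sumV enum (λ a → f a ·ᵥ basis (orbit a)) ≈ᵥ lincomb (coordinates f) basis
        regroup f y = begin
          sumV enum (λ a → f a ·ᵥ basis (orbit a)) y
            ≡⟨ sumV-pt enum _ y ⟩
          sumL enum (λ a → f a * basis (orbit a) y)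
            ≈⟨ sumL-cong enum (λ a → *-congˡ (sumL-⟦≟⟧′ Fin._≟_ (allFin⁺ m) (∈-allFin (orbit a)) _)) ⟨
          sumL enum (λ a → f a * sumL (allFin m) (λ i → χ i a * basis i y))
            ≈⟨ sumL-cong enum (λ a → trans (sumL-*ˡ (f a) (allFin m) _)
                                           (sumL-cong (allFin m) λ i → x∙yz≈yx∙z (f a) _ _)) ⟩
          sumL enum (λ a → sumL (allFin m) (λ i → (χ i a * f a) * basis i y))
            ≈⟨ sumL-swap enum (allFin m) _ ⟩
          sumL (allFin m) (λ i → sumL enum (λ a → (χ i a * f a) * basis i y))
            ≈⟨ sumL-cong (allFin m) (λ i → sumL-*ʳ enum _ (basis i y)) ⟨
          sumL (allFin m) (λ i → coordinates f i * basis i y)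
            ≡⟨ sumV-pt (allFin m) _ y ⟨
          lincomb (coordinates f) basis y
            ∎

        spans : ∀ f → f ~ lincomb (coordinates f) basis
        spans f = ~-trans (~-reflexive (expand f))
                 (~-trans (sumV-cong-~ enum λ a → ·ᵥ-cong-~ (f a) (e-resp-↝* (↝*-rep a)))
                          (~-reflexive (regroup f)))

        hasDim : HasDim m
        hasDim = basis , independent , λ f → coordinates f , spans f

  module Transport (X Y : Set) (enumX : List X) (enumY : List Y)
                   (_≟X_ : DecidableEquality X) (_≟Y_ : DecidableEquality Y)
                   (n : ℕ) (actX : Permutation′ n → X → X) (actY : Permutation′ n → Y → Y)
                   (ι : X ↔ Y) (enumY≡ : enumY ≡ map (Inverse.to ι) enumX)
                   (ι-equivariant : ∀ σ a → Inverse.to ι (actX σ a) ≡ actY σ (Inverse.to ι a)) where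
    open Inverse ι using (to; from; strictlyInverseʳ; inverseˡ; inverseʳ)
    module VX = Free X enumX _≟X_ n actX
    module VY = Free Y enumY _≟Y_ n actY
    module LX = FreeProperties X enumX _≟X_ n actX
    module LY = FreeProperties Y enumY _≟Y_ n actY

    transport : VX.V → VY.V
    transport f = f ∘ from

    transport-to : ∀ f a → transport f (to a) ≈ f a
    transport-to f a = reflexive (≡.cong f (strictlyInverseʳ a))

    sumL-enumY : ∀ (G : Y → Carrier) → sumL enumY G ≡ sumL enumX (G ∘ to)
    sumL-enumY G = ≡.trans (≡.cong (λ ys → sumL ys G) enumY≡) (sumL-map to enumX G)

    [≟ᵏ]-transport : ∀ {b} a y → to a ≡ b → VX.[ a ≟ᵏ from y ] ≈ VY.[ b ≟ᵏ y ]
    [≟ᵏ]-transport a y ≡.refl = begin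
      VX.[ a ≟ᵏ from y ]  ≡⟨ LX.[≟ᵏ]≡⟦≟⟧ a (from y) ⟩
      ⟦ a ≟X from y ⟧     ≈⟨ ⟦⟧-⇔ (mk⇔ inverseˡ λ ta≡y → ≡.sym (inverseʳ (≡.sym ta≡y)))
                                 (a ≟X from y) (to a ≟Y y) ⟩
      ⟦ to a ≟Y y ⟧       ≡⟨ LY.[≟ᵏ]≡⟦≟⟧ (to a) y ⟨
      VY.[ to a ≟ᵏ y ]    ∎

    transport-lin1 : ∀ (hX : X → X) (hY : Y → Y) → (∀ a → to (hX a) ≡ hY (to a)) →
                     ∀ f → transport (VX.lin1 hX f) VY.≈ᵥ VY.lin1 hY (transport f)
    transport-lin1 hX hY to-h f y = begin
      sumL enumX (λ a → VX.[ hX a ≟ᵏ from y ] * f a)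
        ≈⟨ sumL-cong enumX (λ a → *-cong ([≟ᵏ]-transport (hX a) y (to-h a)) (sym (transport-to f a))) ⟩
      sumL enumX (λ a → VY.[ hY (to a) ≟ᵏ y ] * f (from (to a)))
        ≡⟨ sumL-enumY _ ⟨
      sumL enumY (λ b → VY.[ hY b ≟ᵏ y ] * f (from b))
        ∎

    transport-lin2 : ∀ (opX : X → X → X) (opY : Y → Y → Y) →
                     (∀ a a′ → to (opX a a′) ≡ opY (to a) (to a′)) →
                     ∀ f g → transport (VX.lin2 opX f g) VY.≈ᵥ VY.lin2 opY (transport f) (transport g)
    transport-lin2 opX opY to-op f g y = begin
      sumL enumX (λ a → sumL enumX (λ a′ → VX.[ opX a a′ ≟ᵏ from y ] * (f a * g a′)))
        ≈⟨ sumL-cong enumX (λ a → sumL-cong enumX λ a′ →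
             *-cong ([≟ᵏ]-transport (opX a a′) y (to-op a a′))
                    (*-cong (sym (transport-to f a)) (sym (transport-to g a′)))) ⟩
      sumL enumX (λ a → sumL enumX (λ a′ →
        VY.[ opY (to a) (to a′) ≟ᵏ y ] * (transport f (to a) * transport g (to a′))))
        ≈⟨ sumL-cong enumX (λ a → reflexive (sumL-enumY _)) ⟨
      sumL enumX (λ a → sumL enumY (λ b′ → VY.[ opY (to a) b′ ≟ᵏ y ] * (transport f (to a) * transport g b′)))
        ≡⟨ sumL-enumY _ ⟨
      sumL enumY (λ b → sumL enumY (λ b′ → VY.[ opY b b′ ≟ᵏ y ] * (transport f b * transport g b′)))
        ∎

    transport-▷ : ∀ σ f → transport (σ VX.▷ f) VY.≈ᵥ (σ VY.▷ transport f)
    transport-▷ σ = transport-lin1 (actX σ) (actY σ) (ι-equivariant σ)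

    transport-avg : ∀ (mulX : VX.V → VX.V → VX.V) (mulY : VY.V → VY.V → VY.V) →
                    (∀ f {g g′} → g VY.≈ᵥ g′ → mulY f g VY.≈ᵥ mulY f g′) →
                    (∀ f g → transport (mulX f g) VY.≈ᵥ mulY (transport f) (transport g)) →
                    ∀ f g → transport (VX.avg mulX f g) VY.≈ᵥ VY.avg mulY (transport f) (transport g)
    transport-avg mulX mulY mulY-congʳ transport-mul f g y = *-congˡ (begin
      VX.sumV (allPerms n) (λ σ → mulX f (σ VX.▷ g)) (from y)
        ≡⟨ LX.sumV-pt (allPerms n) _ (from y) ⟩
      sumL (allPerms n) (λ σ → mulX f (σ VX.▷ g) (from y))
        ≈⟨ sumL-cong (allPerms n) (λ σ → trans (transport-mul f (σ VX.▷ g) y)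
                                              (mulY-congʳ _ (transport-▷ σ g) y)) ⟩
      sumL (allPerms n) (λ σ → mulY (transport f) (σ VY.▷ transport g) y)
        ≡⟨ LY.sumV-pt (allPerms n) _ y ⟨
      VY.sumV (allPerms n) (λ σ → mulY (transport f) (σ VY.▷ transport g)) y
        ∎)

    transport-avg-lin2 : ∀ (opX : X → X → X) (opY : Y → Y → Y) →
                         (∀ a a′ → to (opX a a′) ≡ opY (to a) (to a′)) →
                         ∀ f g → transport (VX.avg (VX.lin2 opX) f g)
                                   VY.≈ᵥ VY.avg (VY.lin2 opY) (transport f) (transport g)
    transport-avg-lin2 opX opY to-op =
      transport-avg (VX.lin2 opX) (VY.lin2 opY) (LY.lin2-congʳ opY) (transport-lin2 opX opY to-op)

    transport-resp-~ : ∀ f g → f VX.~ g → transport f VY.~ transport g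
    transport-resp-~ f g (ts , f-g≈) =
      map (map₂ (map₂ transport)) ts , λ y → trans (f-g≈ (from y)) (relators ts y)
      where
      relators : ∀ ts y → VX.sumV ts LX.relator (from y)
                          ≈ VY.sumV (map (map₂ (map₂ transport)) ts) LY.relator y
      relators []                 y = refl
      relators ((k , σ , h) ∷ ts) y = +-cong (*-congˡ (+-congʳ (transport-▷ σ h y))) (relators ts y)

  module SubsetsToWords (n : ℕ) =
    Transport (Subset n) (Vec (Subset 1) n) (allSubsets n) (allWords n)
              (≡-dec Bool._≟_) (≡-dec (≡-dec Bool._≟_)) n actSubset actWord
              singletons (allWords≡ n) map-[_]-actSubset

  module WordsToSubsets (n : ℕ) =
    Transport (Vec (Subset 1) n) (Subset n) (allWords n) (allSubsets n)
              (≡-dec (≡-dec Bool._≟_)) (≡-dec Bool._≟_) n actWord actSubset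
              (↔-sym singletons) (map-from singletons (allWords≡ n))
              (from-equivariant singletons map-[_]-actSubset)

  module SubsetOrbits (n : ℕ) =
    FreeProperties.Basis.Orbits (Subset n) (allSubsets n) (≡-dec Bool._≟_) n actSubset
      (allSubsets-unique n) ∈-allSubsets size size-actSubset (prefix ∘ toℕ) size-prefix ↝*-prefix-size

proposition3p3 : {c ℓ : Level} (F : CharZeroField c ℓ) (n : ℕ) → Constructions.Prop33 F n
proposition3p3 F n =
    ( P→T.transport , T→P.transport , P→T.transport-resp-~ , T→P.transport-resp-~
    , (λ _ _ → T.~-reflexive λ _ → refl) , (λ _ _ → T.~-reflexive λ _ → refl)
    , (λ f → P.~-reflexive (P→T.transport-to f)) , (λ g → T.~-reflexive (T→P.transport-to g))
    , (λ f g → T.~-reflexive (P→T.transport-avg-lin2 _∪_ _∪w_ (map-[_]-zipWith _∨_) f g))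
    , (λ f g → T.~-reflexive (P→T.transport-avg-lin2 _∩_ _∩w_ (map-[_]-zipWith _∧_) f g))
    , (λ f → T.~-reflexive (P→T.transport-lin1 ∁ ∁w (map-[_]-map not) f)) )
  , SubsetOrbits.hasDim n
  where
  open Coinvariants F
  open CharZeroField F using (refl)
  module P→T = SubsetsToWords n
  module T→P = WordsToSubsets n
  module P = P→T.LX
  module T = P→T.LY
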